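{- Define $\alpha'(k) = \min \{n\ge 0 : t(n) = k\}$. Then $\alpha'(k) = m(k) -1$ for all integers $k \geq 1$.
   Context: Let $(a(n))_{n\ge 0}$ be the Rudin-Shapiro sequence, defined by $a(0)=1$, $a(2n)=a(n)$, $a(2n+1)=(-1)^n a(n)$ for $n\ge 0$. Let $t(n)=\sum_{0\le i\le n}(-1)^i a(i)$. For $k\ge 0$, $m(k)$ denotes the integer obtained by reading the base-$2$ representation of $k$ as a base-$4$ numeral; i.e., if $k=\sum_i c_i 2^i$ with $c_i\in\{0,1\}$, then $m(k)=\sum_i c_i 4^i$. -}

module Defs where

open import Data.Nat using (ℕ; zero; suc; _+_; _*_; _∸_; _<_)
open import Data.Nat.DivMod using (_/_; _%_)
open import Data.Integer using (ℤ; +_; -_)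
import Data.Integer as ℤ
open import Data.Bool using (Bool; true; false; if_then_else_)
open import Data.Nat using (_≡ᵇ_)
open import Data.Product using (_×_)
open import Relation.Nullary using (¬_)

neg1^ : ℕ → ℤ
neg1^ zero = + 1
neg1^ (suc n) = - neg1^ n

-- Rudin-Shapiro sequence: a(0)=1, a(2n)=a(n), a(2n+1)=(-1)^n a(n).
-- Implemented with fuel (fuel ≥ n suffices, since n/2 < n for n ≥ 1).
rsFuel : ℕ → ℕ → ℤ
rsFuel zero    _ = + 1
rsFuel (suc f) zero = + 1
rsFuel (suc f) n@(suc _) =
  if (n % 2) ≡ᵇ 0
  then rsFuel f (n / 2)
  else neg1^ (n / 2) ℤ.* rsFuel f (n / 2)

rs : ℕ → ℤ
rs n = rsFuel n n

t : ℕ → ℤ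
t zero = rs 0
t (suc n) = t n ℤ.+ neg1^ (suc n) ℤ.* rs (suc n)

mFuel : ℕ → ℕ → ℕ
mFuel zero _ = 0
mFuel (suc f) zero = 0
mFuel (suc f) n@(suc _) = n % 2 + 4 * mFuel f (n / 2)

m : ℕ → ℕ
m k = mFuel k k

-- α'(k) = min { n ≥ 0 : t(n) = k }, characterised as: "n is the least n with t(n) = k"
IsLeast : (ℕ → Set) → ℕ → Set
IsLeast P n = P n × (∀ j → j < n → ¬ P j)

{-# OPTIONS --safe #-}
-- With S n = t(n − 1) the sum of the first n terms (−1)^i a(i), the recursions for a
-- give S(4q) = S(4q+2) = 2 S(q), S(4q+1) = 2 S(q) + a(q) and S(4q+3) = 2 S(q) ± 1.
-- As a(m k) = 1, induction on the binary digits of k gives S(m k) = k. Conversely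
-- S N < k whenever N < m k, by strong induction: for N = 4q + r and k = 2k' + e,
-- either q < m k', and then S N ≤ 2 S q + 1 < 2k', or e = 1 and N = 4 m k' = m (2k'),
-- where S N = 2k'.
module Submission where

open import Defs
open import Data.Bool using (true; false; if_then_else_)
open import Data.Integer as ℤ using (ℤ; +_; -_; ∣_∣; +<+; -≤+)
import Data.Integer.Properties as ℤ
open import Data.Integer.Tactic.RingSolver using (solve-∀)
open import Data.Nat using (ℕ; zero; suc; _+_; _*_; _∸_; _≤_; _<_; _≥_; z≤n; s≤s; s≤s⁻¹; _≡ᵇ_; NonZero)
import Data.Nat.Properties as ℕ
open import Data.Nat.DivMod using (_/_; _%_; m/n<m; m*n%n≡0; [m+kn]%n≡m%n; m*n/n≡m; +-distrib-/; m%n<n; m≡m%n+[m/n]*n)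
open import Data.Nat.Induction using (<-rec)
import Data.Nat.Tactic.RingSolver as ℕ-Solver
open import Data.Product using (_,_)
open import Data.Sum using (inj₁; inj₂)
open import Relation.Binary.PropositionalEquality

[1+n]/2≤n : ∀ n → suc n / 2 ≤ n
[1+n]/2≤n n = s≤s⁻¹ (m/n<m (suc n) 2 (s≤s (s≤s z≤n)))

rsFuel-stable : ∀ {f g} n → n ≤ f → n ≤ g → rsFuel f n ≡ rsFuel g n
rsFuel-stable {zero}  {zero}  zero _ _ = refl
rsFuel-stable {zero}  {suc _} zero _ _ = refl
rsFuel-stable {suc _} {zero}  zero _ _ = refl
rsFuel-stable {suc _} {suc _} zero _ _ = refl
rsFuel-stable {suc _} {suc _} n@(suc n′) (s≤s n′≤f) (s≤s n′≤g) =
  cong (λ r → if n % 2 ≡ᵇ 0 then r else neg1^ (n / 2) ℤ.* r)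
       (rsFuel-stable (n / 2) (ℕ.≤-trans ([1+n]/2≤n n′) n′≤f) (ℕ.≤-trans ([1+n]/2≤n n′) n′≤g))

mFuel-stable : ∀ {f g} n → n ≤ f → n ≤ g → mFuel f n ≡ mFuel g n
mFuel-stable {zero}  {zero}  zero _ _ = refl
mFuel-stable {zero}  {suc _} zero _ _ = refl
mFuel-stable {suc _} {zero}  zero _ _ = refl
mFuel-stable {suc _} {suc _} zero _ _ = refl
mFuel-stable {suc _} {suc _} n@(suc n′) (s≤s n′≤f) (s≤s n′≤g) =
  cong (λ r → n % 2 + 4 * r)
       (mFuel-stable (n / 2) (ℕ.≤-trans ([1+n]/2≤n n′) n′≤f) (ℕ.≤-trans ([1+n]/2≤n n′) n′≤g))

rs-unfold : ∀ n → rs n ≡ (if n % 2 ≡ᵇ 0 then rs (n / 2) else neg1^ (n / 2) ℤ.* rs (n / 2))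
rs-unfold zero = refl
rs-unfold n@(suc n′) =
  cong (λ r → if n % 2 ≡ᵇ 0 then r else neg1^ (n / 2) ℤ.* r)
       (rsFuel-stable (n / 2) ([1+n]/2≤n n′) ℕ.≤-refl)

m-unfold : ∀ n → m n ≡ n % 2 + 4 * m (n / 2)
m-unfold zero = refl
m-unfold n@(suc n′) = cong (λ r → n % 2 + 4 * r) (mFuel-stable (n / 2) ([1+n]/2≤n n′) ℕ.≤-refl)

2*n%2≡0 : ∀ n → 2 * n % 2 ≡ 0
2*n%2≡0 n = trans (cong (_% 2) (ℕ.*-comm 2 n)) (m*n%n≡0 n 2)

[1+2*n]%2≡1 : ∀ n → (1 + 2 * n) % 2 ≡ 1
[1+2*n]%2≡1 n = trans (cong (λ x → (1 + x) % 2) (ℕ.*-comm 2 n)) ([m+kn]%n≡m%n 1 n 2)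

2*n/2≡n : ∀ n → 2 * n / 2 ≡ n
2*n/2≡n n = trans (cong (_/ 2) (ℕ.*-comm 2 n)) (m*n/n≡m n 2)

[1+2*n]/2≡n : ∀ n → (1 + 2 * n) / 2 ≡ n
[1+2*n]/2≡n n = trans (+-distrib-/ 1 (2 * n) 1%2+2n%2<2) (2*n/2≡n n)
  where
  1%2+2n%2<2 : 1 % 2 + 2 * n % 2 < 2
  1%2+2n%2<2 = subst (λ x → 1 + x < 2) (sym (2*n%2≡0 n)) ℕ.≤-refl

rs-2* : ∀ n → rs (2 * n) ≡ rs n
rs-2* n rewrite rs-unfold (2 * n) | 2*n%2≡0 n | 2*n/2≡n n = refl

rs-1+2* : ∀ n → rs (1 + 2 * n) ≡ neg1^ n ℤ.* rs n
rs-1+2* n rewrite rs-unfold (1 + 2 * n) | [1+2*n]%2≡1 n | [1+2*n]/2≡n n = refl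

m-2* : ∀ n → m (2 * n) ≡ 4 * m n
m-2* n = trans (m-unfold (2 * n)) (cong₂ (λ r q → r + 4 * m q) (2*n%2≡0 n) (2*n/2≡n n))

m-1+2* : ∀ n → m (1 + 2 * n) ≡ 1 + 4 * m n
m-1+2* n = trans (m-unfold (1 + 2 * n)) (cong₂ (λ r q → r + 4 * m q) ([1+2*n]%2≡1 n) ([1+2*n]/2≡n n))

neg1^-2* : ∀ n → neg1^ (2 * n) ≡ + 1
neg1^-2* zero = refl
neg1^-2* (suc n) = trans (cong neg1^ (ℕ.*-suc 2 n)) (trans (ℤ.neg-involutive _) (neg1^-2* n))

neg1^-1+2* : ∀ n → neg1^ (1 + 2 * n) ≡ - + 1
neg1^-1+2* n = cong -_ (neg1^-2* n)

∣neg1^∣ : ∀ n → ∣ neg1^ n ∣ ≡ 1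
∣neg1^∣ zero = refl
∣neg1^∣ (suc n) = trans (ℤ.∣-i∣≡∣i∣ (neg1^ n)) (∣neg1^∣ n)

∣rsFuel∣ : ∀ f n → ∣ rsFuel f n ∣ ≡ 1
∣rsFuel∣ zero    _ = refl
∣rsFuel∣ (suc f) zero = refl
∣rsFuel∣ (suc f) (suc n) with suc n % 2 ≡ᵇ 0
... | true  = ∣rsFuel∣ f (suc n / 2)
... | false = trans (ℤ.abs-* (neg1^ (suc n / 2)) (rsFuel f (suc n / 2)))
                    (cong₂ _*_ (∣neg1^∣ (suc n / 2)) (∣rsFuel∣ f (suc n / 2)))

∣i∣≡1⇒i≤1 : ∀ {i} → ∣ i ∣ ≡ 1 → i ℤ.≤ + 1
∣i∣≡1⇒i≤1 {+ 1}        refl = ℤ.≤-refl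
∣i∣≡1⇒i≤1 {ℤ.-[1+ 0 ]} refl = -≤+

∣rs∣ : ∀ n → ∣ rs n ∣ ≡ 1
∣rs∣ n = ∣rsFuel∣ n n

rs≤1 : ∀ n → rs n ℤ.≤ + 1
rs≤1 n = ∣i∣≡1⇒i≤1 (∣rs∣ n)

signedRs : ℕ → ℤ
signedRs n = neg1^ n ℤ.* rs n

signedRs≤1 : ∀ n → signedRs n ℤ.≤ + 1
signedRs≤1 n = ∣i∣≡1⇒i≤1 (trans (ℤ.abs-* (neg1^ n) (rs n)) (cong₂ _*_ (∣neg1^∣ n) (∣rs∣ n)))

4*n≡2*[2*n] : ∀ n → 4 * n ≡ 2 * (2 * n)
4*n≡2*[2*n] = ℕ-Solver.solve-∀

rs-4* : ∀ n → rs (4 * n) ≡ rs n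
rs-4* n = trans (cong rs (4*n≡2*[2*n] n)) (trans (rs-2* (2 * n)) (rs-2* n))

rs-1+4* : ∀ n → rs (1 + 4 * n) ≡ rs n
rs-1+4* n = begin
  rs (1 + 4 * n)                       ≡⟨ cong (λ x → rs (1 + x)) (4*n≡2*[2*n] n) ⟩
  rs (1 + 2 * (2 * n))                 ≡⟨ rs-1+2* (2 * n) ⟩
  neg1^ (2 * n) ℤ.* rs (2 * n)         ≡⟨ cong₂ ℤ._*_ (neg1^-2* n) (rs-2* n) ⟩
  + 1 ℤ.* rs n                         ≡⟨ ℤ.*-identityˡ (rs n) ⟩
  rs n                                 ∎
  where open ≡-Reasoning

2+4*n≡2*[1+2*n] : ∀ n → 2 + 4 * n ≡ 2 * (1 + 2 * n)
2+4*n≡2*[1+2*n] = ℕ-Solver.solve-∀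

signedRs-4* : ∀ n → signedRs (4 * n) ≡ rs n
signedRs-4* n = begin
  neg1^ (4 * n) ℤ.* rs (4 * n)               ≡⟨ cong₂ ℤ._*_ (cong neg1^ (4*n≡2*[2*n] n)) (rs-4* n) ⟩
  neg1^ (2 * (2 * n)) ℤ.* rs n               ≡⟨ cong (ℤ._* rs n) (neg1^-2* (2 * n)) ⟩
  + 1 ℤ.* rs n                               ≡⟨ ℤ.*-identityˡ (rs n) ⟩
  rs n                                       ∎
  where open ≡-Reasoning

signedRs-1+4* : ∀ n → signedRs (1 + 4 * n) ≡ - rs n
signedRs-1+4* n = begin
  neg1^ (1 + 4 * n) ℤ.* rs (1 + 4 * n)               ≡⟨ cong₂ ℤ._*_ (cong (λ x → neg1^ (1 + x)) (4*n≡2*[2*n] n)) (rs-1+4* n) ⟩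
  neg1^ (1 + 2 * (2 * n)) ℤ.* rs n                   ≡⟨ cong (ℤ._* rs n) (neg1^-1+2* (2 * n)) ⟩
  - + 1 ℤ.* rs n                                     ≡⟨ ℤ.-1*i≡-i (rs n) ⟩
  - rs n                                             ∎
  where open ≡-Reasoning

signedRs-2+4* : ∀ n → signedRs (2 + 4 * n) ≡ signedRs n
signedRs-2+4* n = begin
  signedRs (2 + 4 * n)                               ≡⟨ cong signedRs (2+4*n≡2*[1+2*n] n) ⟩
  neg1^ (2 * (1 + 2 * n)) ℤ.* rs (2 * (1 + 2 * n))   ≡⟨ cong₂ ℤ._*_ (neg1^-2* (1 + 2 * n)) (trans (rs-2* (1 + 2 * n)) (rs-1+2* n)) ⟩
  + 1 ℤ.* signedRs n                                 ≡⟨ ℤ.*-identityˡ (signedRs n) ⟩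
  signedRs n                                         ∎
  where open ≡-Reasoning

signedRs-3+4* : ∀ n → signedRs (3 + 4 * n) ≡ signedRs n
signedRs-3+4* n = begin
  signedRs (3 + 4 * n)                                       ≡⟨ cong (λ x → signedRs (1 + x)) (2+4*n≡2*[1+2*n] n) ⟩
  neg1^ (1 + 2 * (1 + 2 * n)) ℤ.* rs (1 + 2 * (1 + 2 * n))   ≡⟨ cong₂ ℤ._*_ (neg1^-1+2* (1 + 2 * n)) (trans (rs-1+2* (1 + 2 * n)) (cong (ℤ._* rs (1 + 2 * n)) (neg1^-1+2* n))) ⟩
  - + 1 ℤ.* (- + 1 ℤ.* rs (1 + 2 * n))                       ≡⟨ -1*-1*i≡i (rs (1 + 2 * n)) ⟩
  rs (1 + 2 * n)                                             ≡⟨ rs-1+2* n ⟩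
  signedRs n                                                 ∎
  where
  open ≡-Reasoning
  -1*-1*i≡i : ∀ i → - + 1 ℤ.* (- + 1 ℤ.* i) ≡ i
  -1*-1*i≡i = solve-∀

S : ℕ → ℤ
S zero    = + 0
S (suc n) = t n

S-suc : ∀ n → S (suc n) ≡ S n ℤ.+ signedRs n
S-suc zero    = refl
S-suc (suc n) = refl

S-4* : ∀ q → S (4 * q) ≡ + 2 ℤ.* S q

S-1+4* : ∀ q → S (1 + 4 * q) ≡ + 2 ℤ.* S q ℤ.+ rs q
S-1+4* q = trans (S-suc (4 * q)) (cong₂ ℤ._+_ (S-4* q) (signedRs-4* q))

S-2+4* : ∀ q → S (2 + 4 * q) ≡ + 2 ℤ.* S q
S-2+4* q = begin
  S (2 + 4 * q)                                ≡⟨ S-suc (1 + 4 * q) ⟩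
  S (1 + 4 * q) ℤ.+ signedRs (1 + 4 * q)       ≡⟨ cong₂ ℤ._+_ (S-1+4* q) (signedRs-1+4* q) ⟩
  + 2 ℤ.* S q ℤ.+ rs q ℤ.+ - rs q              ≡⟨ cancel (+ 2 ℤ.* S q) (rs q) ⟩
  + 2 ℤ.* S q                                  ∎
  where
  open ≡-Reasoning
  cancel : ∀ x y → x ℤ.+ y ℤ.+ - y ≡ x
  cancel = solve-∀

S-3+4* : ∀ q → S (3 + 4 * q) ≡ + 2 ℤ.* S q ℤ.+ signedRs q
S-3+4* q = trans (S-suc (2 + 4 * q)) (cong₂ ℤ._+_ (S-2+4* q) (signedRs-2+4* q))

S-4* zero    = refl
S-4* (suc q) = begin
  S (4 * suc q)                                ≡⟨ cong S (ℕ.*-suc 4 q) ⟩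
  S (suc (3 + 4 * q))                          ≡⟨ S-suc (3 + 4 * q) ⟩
  S (3 + 4 * q) ℤ.+ signedRs (3 + 4 * q)       ≡⟨ cong₂ ℤ._+_ (S-3+4* q) (signedRs-3+4* q) ⟩
  + 2 ℤ.* S q ℤ.+ signedRs q ℤ.+ signedRs q    ≡⟨ distrib (S q) (signedRs q) ⟩
  + 2 ℤ.* (S q ℤ.+ signedRs q)                 ≡⟨ cong (+ 2 ℤ.*_) (S-suc q) ⟨
  + 2 ℤ.* S (suc q)                            ∎
  where
  open ≡-Reasoning
  distrib : ∀ x y → + 2 ℤ.* x ℤ.+ y ℤ.+ y ≡ + 2 ℤ.* (x ℤ.+ y)
  distrib = solve-∀

S[r+4*q]≤2*S[q]+1 : ∀ q r → r < 4 → S (r + 4 * q) ℤ.≤ + 2 ℤ.* S q ℤ.+ + 1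
S[r+4*q]≤2*S[q]+1 q 0 _ = ℤ.≤-trans (ℤ.≤-reflexive (S-4* q)) (ℤ.i≤i+j _ (+ 1))
S[r+4*q]≤2*S[q]+1 q 1 _ = ℤ.≤-trans (ℤ.≤-reflexive (S-1+4* q)) (ℤ.+-monoʳ-≤ (+ 2 ℤ.* S q) (rs≤1 q))
S[r+4*q]≤2*S[q]+1 q 2 _ = ℤ.≤-trans (ℤ.≤-reflexive (S-2+4* q)) (ℤ.i≤i+j _ (+ 1))
S[r+4*q]≤2*S[q]+1 q 3 _ = ℤ.≤-trans (ℤ.≤-reflexive (S-3+4* q)) (ℤ.+-monoʳ-≤ (+ 2 ℤ.* S q) (signedRs≤1 q))
S[r+4*q]≤2*S[q]+1 q (suc (suc (suc (suc _)))) (s≤s (s≤s (s≤s (s≤s ()))))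

data ParityView : ℕ → Set where
  even : ∀ n → ParityView (2 * n)
  odd  : ∀ n → ParityView (1 + 2 * n)

parityView : ∀ n → ParityView n
parityView zero = even 0
parityView (suc n) with parityView n
... | even k = odd k
... | odd k  = subst ParityView (ℕ.*-suc 2 k) (even (suc k))

binary-ind : (P : ℕ → Set) → P 0 → (∀ n → P n → P (2 * n)) → (∀ n → P n → P (1 + 2 * n)) →
             ∀ n → P n
binary-ind P p0 p-even p-odd = <-rec P step
  where
  step : ∀ n → (∀ {k} → k < n → P k) → P n
  step n rec with parityView n
  ... | even zero      = p0
  ... | even k@(suc _) = p-even k (rec (subst (k <_) (ℕ.*-comm k 2) (ℕ.m<m*n k 2 ℕ.≤-refl)))
  ... | odd k          = p-odd k (rec (s≤s (ℕ.m≤m+n k _)))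

rs[m[k]]≡1 : ∀ k → rs (m k) ≡ + 1
rs[m[k]]≡1 = binary-ind (λ k → rs (m k) ≡ + 1) refl
  (λ k ih → trans (cong rs (m-2* k)) (trans (rs-4* (m k)) ih))
  (λ k ih → trans (cong rs (m-1+2* k)) (trans (rs-1+4* (m k)) ih))

S[m[k]]≡k : ∀ k → S (m k) ≡ + k
S[m[k]]≡k = binary-ind (λ k → S (m k) ≡ + k) refl
  (λ k ih → begin
    S (m (2 * k))                    ≡⟨ cong S (m-2* k) ⟩
    S (4 * m k)                      ≡⟨ S-4* (m k) ⟩
    + 2 ℤ.* S (m k)                  ≡⟨ cong (+ 2 ℤ.*_) ih ⟩
    + 2 ℤ.* + k                      ≡⟨ ℤ.pos-* 2 k ⟨
    + (2 * k)                        ∎)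
  (λ k ih → begin
    S (m (1 + 2 * k))                ≡⟨ cong S (m-1+2* k) ⟩
    S (1 + 4 * m k)                  ≡⟨ S-1+4* (m k) ⟩
    + 2 ℤ.* S (m k) ℤ.+ rs (m k)     ≡⟨ cong₂ (λ x y → + 2 ℤ.* x ℤ.+ y) ih (rs[m[k]]≡1 k) ⟩
    + 2 ℤ.* + k ℤ.+ + 1              ≡⟨ ℤ.+-comm (+ 2 ℤ.* + k) (+ 1) ⟩
    + 1 ℤ.+ + 2 ℤ.* + k              ≡⟨ cong (ℤ._+_ (+ 1)) (ℤ.pos-* 2 k) ⟨
    + (1 + 2 * k)                    ∎)
  where open ≡-Reasoning

2*i+1<2*n : ∀ {i n} → i ℤ.< + n → + 2 ℤ.* i ℤ.+ + 1 ℤ.< + (2 * n)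
2*i+1<2*n {i} {n} i<n = begin-strict
  + 2 ℤ.* i ℤ.+ + 1        <⟨ ℤ.suc[i]≤j⇒i<j (ℤ.≤-reflexive (suc[2*i+1]≡2*suc[i] i)) ⟩
  + 2 ℤ.* ℤ.suc i          ≤⟨ ℤ.*-monoˡ-≤-nonNeg (+ 2) (ℤ.i<j⇒suc[i]≤j i<n) ⟩
  + 2 ℤ.* + n              ≡⟨ ℤ.pos-* 2 n ⟨
  + (2 * n)                ∎
  where
  open ℤ.≤-Reasoning
  suc[2*i+1]≡2*suc[i] : ∀ i → + 1 ℤ.+ (+ 2 ℤ.* i ℤ.+ + 1) ≡ + 2 ℤ.* (+ 1 ℤ.+ i)
  suc[2*i+1]≡2*suc[i] = solve-∀

m+n*o<n*p⇒o<p : ∀ m n {o p} → m + n * o < n * p → o < p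
m+n*o<n*p⇒o<p m n {o} {p} lt = ℕ.*-cancelˡ-< n o p (ℕ.≤-<-trans (ℕ.m≤n+m (n * o) m) lt)

m+n*o≤n*p⇒o≤p : ∀ m n {o p} .{{_ : NonZero n}} → m + n * o ≤ n * p → o ≤ p
m+n*o≤n*p⇒o≤p m n {o} le = ℕ.*-cancelˡ-≤ n (ℕ.≤-trans (ℕ.m≤n+m (n * o) m) le)

m+n≤n⇒m≡0 : ∀ m n → m + n ≤ n → m ≡ 0
m+n≤n⇒m≡0 m n le = ℕ.n≤0⇒n≡0 (ℕ.+-cancelʳ-≤ n m 0 le)

S[r+4*q]<2*k : ∀ q r k → r < 4 → S q ℤ.< + k → S (r + 4 * q) ℤ.< + (2 * k)
S[r+4*q]<2*k q r k r<4 S[q]<k = ℤ.≤-<-trans (S[r+4*q]≤2*S[q]+1 q r r<4) (2*i+1<2*n S[q]<k)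

BoundedByM : ℕ → Set
BoundedByM N = ∀ {k} → N < m k → S N ℤ.< + k

S[r+4*q]<1+2*k : ∀ q r k → r < 4 → BoundedByM q → r + 4 * q ≤ 4 * m k → S (r + 4 * q) ℤ.< + (1 + 2 * k)
S[r+4*q]<1+2*k q r k r<4 ih le with ℕ.m≤n⇒m<n∨m≡n (m+n*o≤n*p⇒o≤p r 4 {q} {m k} le)
... | inj₁ q<m[k] = ℤ.<-trans (S[r+4*q]<2*k q r k r<4 (ih q<m[k])) (+<+ ℕ.≤-refl)
... | inj₂ refl rewrite m+n≤n⇒m≡0 r (4 * m k) le =
  ℤ.≤-<-trans (ℤ.≤-reflexive (trans (cong S (sym (m-2* k))) (S[m[k]]≡k (2 * k)))) (+<+ ℕ.≤-refl)

S[r+4*q]<k : ∀ q r k → r < 4 → BoundedByM q → r + 4 * q < m k → S (r + 4 * q) ℤ.< + k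
S[r+4*q]<k q r k r<4 ih lt with parityView k
... | even k′ = S[r+4*q]<2*k q r k′ r<4 (ih (m+n*o<n*p⇒o<p r 4 {q} {m k′} (subst (r + 4 * q <_) (m-2* k′) lt)))
... | odd k′  = S[r+4*q]<1+2*k q r k′ r<4 ih (s≤s⁻¹ (subst (r + 4 * q <_) (m-1+2* k′) lt))

n<m[k]⇒S[n]<k : ∀ N → BoundedByM N
n<m[k]⇒S[n]<k = <-rec BoundedByM below
  where
  below : ∀ N → (∀ {q} → q < N → BoundedByM q) → BoundedByM N
  below zero      _   {zero}  ()
  below zero      _   {suc k} _ = +<+ (s≤s z≤n)
  below N@(suc _) rec {k} N<m[k] =
    subst (λ x → S x ℤ.< + k) (sym N≡r+4q)
          (S[r+4*q]<k (N / 4) (N % 4) k (m%n<n N 4) (rec (m/n<m N 4 (s≤s (s≤s z≤n)))) (subst (_< m k) N≡r+4q N<m[k]))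
    where
    N≡r+4q : N ≡ N % 4 + 4 * (N / 4)
    N≡r+4q = trans (m≡m%n+[m/n]*n N 4) (cong (_+_ (N % 4)) (ℕ.*-comm (N / 4) 4))

theorem30 : ∀ (k : ℕ) → k ≥ 1 → IsLeast (λ n → t n ≡ + k) (m k ∸ 1)
theorem30 k k≥1 with m k | S[m[k]]≡k k | (λ N → n<m[k]⇒S[n]<k N {k})
theorem30 (suc k) (s≤s z≤n) | zero | () | _
theorem30 k _ | suc n | t[n]≡k | below =
  t[n]≡k , λ j j<n t[j]≡k → ℤ.<-irrefl t[j]≡k (below (suc j) (s≤s j<n))
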